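{- Let $s>13$ be an integer. Every $[0,s]$-almost intersecting graph that is not a star has at most $2s+3$ edges, and the only graph (up to isomorphism and ignoring isolated vertices) with exactly $2s+3$ edges having these properties is $K_2+E_{s+1}$, i.e. the graph on two adjacent vertices $x_1,x_2$ and $s+1$ further vertices, each joined to both $x_1$ and $x_2$.
   Context: A graph is a finite simple graph, viewed as a set of 2-element edges. It is $[0,s]$-almost intersecting if every edge is disjoint from at most $s$ other edges. A star is a graph in which all edges share a common vertex. -}

module Defs where

open import Data.Nat using (ℕ; _<_; _≤_; _≟_)
open import Data.Nat.Properties using ()
open import Data.Fin using (Fin)
open import Data.Product using (_×_; _,_; proj₁; proj₂; Σ; ∃; ∃-syntax)
open import Data.Sum using (_⊎_)
open import Data.List using (List; length; filter)
open import Data.List.Relation.Unary.All using (All)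
open import Data.List.Relation.Unary.Unique.Propositional using (Unique)
open import Data.List.Membership.Propositional using (_∈_)
open import Relation.Binary.PropositionalEquality using (_≡_; _≢_)
open import Relation.Nullary using (¬_; Dec)
open import Relation.Nullary.Decidable using (_×-dec_; ¬?)
open import Function.Definitions using (Injective)
open import Function.Bundles using (_⇔_)

-- An edge {u , v} is stored as the ordered pair (u , v) with u < v.
Edge : Set
Edge = ℕ × ℕ

record Graph : Set where
  field
    edges    : List Edge
    ordered  : All (λ e → proj₁ e < proj₂ e) edges
    distinct : Unique edges
open Graph public

size : Graph → ℕ
size G = length (edges G)

Disjoint : Edge → Edge → Set
Disjoint (a , b) (c , d) = a ≢ c × a ≢ d × b ≢ c × b ≢ d

disjoint? : (e f : Edge) → Dec (Disjoint e f)
disjoint? (a , b) (c , d) =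
  ¬? (a ≟ c) ×-dec ¬? (a ≟ d) ×-dec ¬? (b ≟ c) ×-dec ¬? (b ≟ d)

-- [0,s]-almost intersecting: every edge is disjoint from at most s other edges
-- (an edge is never disjoint from itself, so counting all edges is the same).
AlmostIntersecting : ℕ → Graph → Set
AlmostIntersecting s G =
  All (λ e → length (filter (disjoint? e) (edges G)) ≤ s) (edges G)

IsStar : Graph → Set
IsStar G = ∃[ v ] All (λ e → v ≡ proj₁ e ⊎ v ≡ proj₂ e) (edges G)

SamePair : ℕ → ℕ → ℕ → ℕ → Set
SamePair a b c d = (a ≡ c × b ≡ d) ⊎ (a ≡ d × b ≡ c)

AdjK2E : (s : ℕ) → ℕ → ℕ → (Fin (Data.Nat.suc s) → ℕ) → ℕ → ℕ → Set
AdjK2E s x₁ x₂ y a b =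
  SamePair a b x₁ x₂ ⊎ (∃[ i ] (SamePair a b x₁ (y i) ⊎ SamePair a b x₂ (y i)))

-- G is (up to isomorphism, ignoring isolated vertices) K₂ + E_{s+1}:
-- there are distinct vertices x₁ , x₂ , y 0 , … , y s such that the edge set
-- of G is exactly {x₁x₂} ∪ {x₁ yᵢ , x₂ yᵢ : i}.
IsK2PlusE : ℕ → Graph → Set
IsK2PlusE s G =
  Σ ℕ λ x₁ → Σ ℕ λ x₂ → Σ (Fin (Data.Nat.suc s) → ℕ) λ y →
    x₁ ≢ x₂ × Injective _≡_ _≡_ y × (∀ i → y i ≢ x₁ × y i ≢ x₂) ×
    (∀ a b → ((a , b) ∈ edges G) ⇔ (a < b × AdjK2E s x₁ x₂ y a b))

-- Let G be a non-star with m ≥ 2s + 3 edges in which every edge misses at most s others.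
-- For an edge ab this says m + 1 ≤ s + deg a + deg b. G has two disjoint edges ab, cd, and
-- counting the edges meeting ab, cd, both or neither shows that at least three of the pairs
-- ac, ad, bc, bd are edges, that at most one edge misses both, and that deg a + deg b ≤ s + 5.
-- All four pairs cannot be edges: in such a K₄ two vertices would either both have all their
-- neighbours inside it, or both have a neighbour of degree ≤ 5 outside it, and either way the
-- degree bound fails (s ≥ 8). So a, b, c, d span K₄ minus an edge bd. Applying the same count
-- to further pairs of disjoint edges, b and d have no neighbours besides the hubs a and c,
-- every edge meets a hub, and the hubs have the same further neighbours; the degree bound at
-- ab and cb then forces deg a = deg c = s + 2. Thus G is the book K₂ + E_{s+1}, which has
-- exactly 2s + 3 edges and is almost intersecting, and no such G has more than 2s + 3 edges.

module Submission where

open import Defs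
open import Data.Empty using (⊥; ⊥-elim)
open import Data.Fin using (Fin; zero; suc)
open import Data.List using (List; []; _∷_; length; filter; map; lookup; tabulate)
open import Data.List.Properties using (filter-some; filter-none; length-map; length-tabulate)
open import Data.List.Membership.Propositional using (_∈_; _∉_; find; lose)
open import Data.List.Membership.Propositional.Properties using (∈-lookup; ∈-map⁺; ∈-map⁻; ∈-filter⁺; ∈-filter⁻; ∈-tabulate⁺; ∈-tabulate⁻)
import Data.List.Relation.Unary.All as All
open import Data.List.Relation.Unary.All.Properties using (¬All⇒Any¬; ¬Any⇒All¬)
import Data.List.Relation.Unary.All.Properties as All
open import Data.List.Relation.Unary.Any using (Any; here; there; any?; index; toSum; fromSum)
import Data.List.Relation.Unary.Any as Any
open import Data.List.Relation.Unary.Any.Properties using (lookup-index)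
import Data.List.Relation.Unary.Unique.Propositional.Properties as Unique
open import Data.Nat using (ℕ; zero; suc; _+_; _*_; _≤_; _<_; z≤n; s≤s; _≟_; _≤?_)
open import Data.Nat.Properties
open import Data.List.Membership.DecPropositional _≟_ using (_∈?_)
open import Data.Nat.Tactic.RingSolver using (solve)
open import Data.Product using (Σ; _×_; _,_; proj₁; proj₂; ∃-syntax)
open import Data.Sum using (_⊎_; inj₁; inj₂; [_,_])
open import Function using (_∘_; case_of_)
open import Function.Bundles using (_⇔_; mk⇔; Equivalence)
open import Function.Definitions using (Injective)
open import Level using (0ℓ)
open import Relation.Binary.PropositionalEquality
  using (_≡_; _≢_; ≢-sym; refl; sym; trans; cong; cong₂; subst; module ≡-Reasoning)
open import Relation.Binary using (tri<; tri≈; tri>)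
open import Relation.Nullary using (¬_; Dec; yes; no; contradiction)
open import Relation.Nullary.Decidable using (_×-dec_; _⊎-dec_)
open import Relation.Unary using (Pred; Decidable)
open import Relation.Unary.Properties using (_∪?_; _∩?_; ∁?)

-- For two disjoint edges: x, y edges meet the first and the second, u meet either, i meet
-- both, n meet neither, out of m edges.
module _ {s m x y u n i : ℕ} (u+i≡x+y : u + i ≡ x + y) (u+n≡m : u + n ≡ m) (m≤s+y : m ≤ s + y) where

  private
    x+y+n≡m+i : x + y + n ≡ m + i
    x+y+n≡m+i = begin
      x + y + n    ≡⟨ cong (_+ n) (sym u+i≡x+y) ⟩
      u + i + n    ≡⟨ solve (u ∷ i ∷ n ∷ []) ⟩
      u + n + i    ≡⟨ cong (_+ i) u+n≡m ⟩
      m + i        ∎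
      where open ≡-Reasoning

  both-count-arith : m ≤ s + x → 2 * s + 3 ≤ m → n + 3 ≤ i
  both-count-arith m≤s+x big = +-cancelˡ-≤ (2 * s + m) _ _ (begin
    2 * s + m + (n + 3)              ≡⟨ solve (s ∷ m ∷ n ∷ []) ⟩
    (2 * s + 3) + (m + n)            ≤⟨ +-monoˡ-≤ (m + n) big ⟩
    m + (m + n)                      ≤⟨ +-mono-≤ m≤s+x (+-monoˡ-≤ n m≤s+y) ⟩
    s + x + (s + y + n)              ≡⟨ solve (s ∷ x ∷ y ∷ n ∷ []) ⟩
    2 * s + (x + y + n)              ≡⟨ cong (2 * s +_) x+y+n≡m+i ⟩
    2 * s + (m + i)                  ≡⟨ sym (+-assoc (2 * s) m i) ⟩
    2 * s + m + i                    ∎)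
    where open ≤-Reasoning

  meet-count-arith : i ≤ 4 → x ≤ s + 4
  meet-count-arith i≤4 = +-cancelʳ-≤ y x (s + 4) (begin
    x + y                            ≤⟨ m≤m+n (x + y) n ⟩
    x + y + n                        ≡⟨ x+y+n≡m+i ⟩
    m + i                            ≤⟨ +-mono-≤ m≤s+y i≤4 ⟩
    s + y + 4                        ≡⟨ solve (s ∷ y ∷ []) ⟩
    s + 4 + y                        ∎)
    where open ≤-Reasoning

k4-low-arith : ∀ {s m x y} → m + 1 ≤ s + (x + y) → x ≤ 3 → y ≤ 3 → 2 * s + 3 ≤ m → s ≤ 2
k4-low-arith {s} {m} {x} {y} m+1≤ x≤3 y≤3 big = +-cancelˡ-≤ (s + 4) s 2 (begin
  s + 4 + s                        ≡⟨ solve (s ∷ []) ⟩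
  2 * s + 3 + 1                    ≤⟨ +-monoˡ-≤ 1 big ⟩
  m + 1                            ≤⟨ m+1≤ ⟩
  s + (x + y)                      ≤⟨ +-monoʳ-≤ s (+-mono-≤ x≤3 y≤3) ⟩
  s + 6                            ≡⟨ sym (+-assoc s 4 2) ⟩
  s + 4 + 2                        ∎)
  where open ≤-Reasoning

k4-high-arith : ∀ {s m x y} → m + 1 ≤ s + (x + 5) → m + 1 ≤ s + (y + 5) → x + y ≤ s + 5 →
  2 * s + 3 ≤ m → s ≤ 7
k4-high-arith {s} {m} {x} {y} m+1≤x m+1≤y x+y≤ big = +-cancelˡ-≤ (3 * s + 8) s 7 (begin
  3 * s + 8 + s                    ≡⟨ solve (s ∷ []) ⟩
  (2 * s + 3 + 1) + (2 * s + 3 + 1) ≤⟨ +-mono-≤ (+-monoˡ-≤ 1 big) (+-monoˡ-≤ 1 big) ⟩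
  (m + 1) + (m + 1)                ≤⟨ +-mono-≤ m+1≤x m+1≤y ⟩
  s + (x + 5) + (s + (y + 5))      ≡⟨ solve (s ∷ x ∷ y ∷ []) ⟩
  2 * s + 10 + (x + y)             ≤⟨ +-monoʳ-≤ (2 * s + 10) x+y≤ ⟩
  2 * s + 10 + (s + 5)             ≡⟨ solve (s ∷ []) ⟩
  3 * s + 8 + 7                    ∎)
  where open ≤-Reasoning

diamond-hub-arith : ∀ {s m x y z} → m + 1 ≡ x + z → m + 1 ≤ s + (x + y) → y ≤ 2 → z ≤ s + 2
diamond-hub-arith {s} {m} {x} {y} {z} m+1≡ m+1≤ y≤2 = +-cancelˡ-≤ x z (s + 2) (begin
  x + z                            ≡⟨ sym m+1≡ ⟩
  m + 1                            ≤⟨ m+1≤ ⟩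
  s + (x + y)                      ≤⟨ +-monoʳ-≤ s (+-monoʳ-≤ x y≤2) ⟩
  s + (x + 2)                      ≡⟨ solve (s ∷ x ∷ []) ⟩
  x + (s + 2)                      ∎)
  where open ≤-Reasoning

diamond-hubs-arith : ∀ {s m x z} → m + 1 ≡ x + z → x ≤ s + 2 → z ≤ s + 2 → 2 * s + 3 ≤ m → x ≡ s + 2
diamond-hubs-arith {s} {m} {x} {z} m+1≡ x≤ z≤ big = ≤-antisym x≤ (+-cancelʳ-≤ z (s + 2) x (begin
  s + 2 + z                        ≤⟨ +-monoʳ-≤ (s + 2) z≤ ⟩
  s + 2 + (s + 2)                  ≡⟨ solve (s ∷ []) ⟩
  2 * s + 3 + 1                    ≤⟨ +-monoˡ-≤ 1 big ⟩
  m + 1                            ≡⟨ m+1≡ ⟩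
  x + z                            ∎))
  where open ≤-Reasoning

book-size-arith : ∀ {m n} → m + 1 ≡ suc n + suc n → m ≡ 2 * n + 1
book-size-arith {m} {n} m+1≡ = +-cancelʳ-≡ 1 m (2 * n + 1) (trans m+1≡ (solve (n ∷ [])))

book-page-arith : ∀ {s d k n} → d + k ≡ 2 * n + 1 → suc n + 2 ≤ k + 1 → n ≡ suc s → d ≤ s
book-page-arith {s} {d} {k} d+k≡ k≥ refl = +-cancelʳ-≤ (s + 3) d s (+-cancelʳ-≤ 1 _ _ (begin
  d + (s + 3) + 1                  ≡⟨ solve (d ∷ s ∷ []) ⟩
  d + (suc (suc s) + 2)            ≤⟨ +-monoʳ-≤ d k≥ ⟩
  d + (k + 1)                      ≡⟨ sym (+-assoc d k 1) ⟩
  d + k + 1                        ≡⟨ cong (_+ 1) d+k≡ ⟩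
  2 * suc s + 1 + 1                ≡⟨ solve (s ∷ []) ⟩
  s + (s + 3) + 1                  ∎))
  where open ≤-Reasoning

size-of-K2+E : ∀ s → 2 * suc s + 1 ≡ 2 * s + 3
size-of-K2+E s = solve (s ∷ [])

4≤2s+3 : ∀ {s} → 1 ≤ s → 4 ≤ 2 * s + 3
4≤2s+3 {s} 1≤s = +-monoˡ-≤ 3 (≤-trans 1≤s (m≤m+n s (s + 0)))

three-bits-set : ∀ {x y z} → x ≤ 1 → y ≤ 1 → z ≤ 1 → 3 ≤ x + (y + z) → 1 ≤ x × 1 ≤ y × 1 ≤ z
three-bits-set (s≤s z≤n) (s≤s z≤n) (s≤s z≤n) _ = s≤s z≤n , s≤s z≤n , s≤s z≤n
three-bits-set (s≤s z≤n) (s≤s z≤n) z≤n       (s≤s (s≤s ()))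
three-bits-set (s≤s z≤n) z≤n       (s≤s z≤n) (s≤s (s≤s ()))
three-bits-set (s≤s z≤n) z≤n       z≤n       (s≤s ())
three-bits-set z≤n       (s≤s z≤n) (s≤s z≤n) (s≤s (s≤s ()))
three-bits-set z≤n       (s≤s z≤n) z≤n       (s≤s ())
three-bits-set z≤n       z≤n       (s≤s z≤n) (s≤s ())
three-bits-set z≤n       z≤n       z≤n       ()

-- Imported only now: the ring solver cannot resolve list syntax overloaded with these constructors.
open import Data.List.Relation.Unary.All using (All; []; _∷_)
open import Data.List.Relation.Unary.Unique.Propositional using (Unique; []; _∷_)

module _ {A : Set} where

  private
    variable
      P Q : Pred A 0ℓ
      x : A

  count : Decidable P → List A → ℕ
  count P? xs = length (filter P? xs)

  count+count-∁ : (P? : Decidable P) (xs : List A) →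
    count P? xs + count (∁? P?) xs ≡ length xs
  count+count-∁ P? [] = refl
  count+count-∁ P? (x ∷ xs) with P? x
  ... | yes _ = cong suc (count+count-∁ P? xs)
  ... | no _ = trans (+-suc _ _) (cong suc (count+count-∁ P? xs))

  count-∪+count-∩ : (P? : Decidable P) (Q? : Decidable Q) (xs : List A) →
    count (P? ∪? Q?) xs + count (P? ∩? Q?) xs ≡ count P? xs + count Q? xs
  count-∪+count-∩ P? Q? [] = refl
  count-∪+count-∩ P? Q? (x ∷ xs) with P? x | Q? x | count-∪+count-∩ P? Q? xs
  ... | yes _ | yes _ | ih = cong suc (trans (+-suc _ _) (trans (cong suc ih) (sym (+-suc _ _))))
  ... | yes _ | no _  | ih = cong suc ih
  ... | no _  | yes _ | ih = trans (cong suc ih) (sym (+-suc _ _))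
  ... | no _  | no _  | ih = ih

  count-mono : (P? : Decidable P) (Q? : Decidable Q) (xs : List A) →
    (∀ {x} → x ∈ xs → P x → Q x) → count P? xs ≤ count Q? xs
  count-mono P? Q? [] P⇒Q = z≤n
  count-mono P? Q? (x ∷ xs) P⇒Q with P? x | Q? x | count-mono P? Q? xs (λ x∈ → P⇒Q (there x∈))
  ... | yes _ | yes _ | ih = s≤s ih
  ... | yes p | no ¬q | _  = ⊥-elim (¬q (P⇒Q (here refl) p))
  ... | no _  | yes _ | ih = m≤n⇒m≤1+n ih
  ... | no _  | no _  | ih = ih

  count-cong : (P? : Decidable P) (Q? : Decidable Q) (xs : List A) →
    (∀ {x} → x ∈ xs → P x → Q x) → (∀ {x} → x ∈ xs → Q x → P x) →
    count P? xs ≡ count Q? xs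
  count-cong P? Q? xs P⇒Q Q⇒P = ≤-antisym (count-mono P? Q? xs P⇒Q) (count-mono Q? P? xs Q⇒P)

  count-none : (P? : Decidable P) (xs : List A) → (∀ {x} → x ∈ xs → ¬ P x) → count P? xs ≡ 0
  count-none P? xs ¬P = cong length (filter-none P? (All.tabulate ¬P))

  count-all : (P? : Decidable P) (xs : List A) → (∀ {x} → x ∈ xs → P x) → count P? xs ≡ length xs
  count-all P? xs all = begin
    count P? xs                          ≡⟨ sym (+-identityʳ _) ⟩
    count P? xs + 0                      ≡⟨ cong (count P? xs +_) (sym (count-none (∁? P?) xs (λ x∈ ¬px → ¬px (all x∈)))) ⟩
    count P? xs + count (∁? P?) xs       ≡⟨ count+count-∁ P? xs ⟩
    length xs                            ∎
    where open ≡-Reasoning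

  count-some : (P? : Decidable P) (xs : List A) → x ∈ xs → P x → 1 ≤ count P? xs
  count-some P? xs x∈ px = filter-some P? (lose x∈ px)

  count-witness : (P? : Decidable P) (xs : List A) → 1 ≤ count P? xs → ∃[ x ] (x ∈ xs × P x)
  count-witness P? (y ∷ ys) pos with P? y
  ... | yes py = y , here refl , py
  ... | no _ with count-witness P? ys pos
  ... | x , x∈ , px = x , there x∈ , px

  count-≤1 : (P? : Decidable P) (xs : List A) → Unique xs →
    (∀ {x y} → x ∈ xs → y ∈ xs → P x → P y → x ≡ y) → count P? xs ≤ 1
  count-≤1 P? [] _ _ = z≤n
  count-≤1 P? (x ∷ xs) (x∉ ∷ u) P-unique with P? x
  ... | yes px = s≤s (≤-reflexive (count-none P? xs λ y∈ py →
                  All.lookup x∉ y∈ (P-unique (here refl) (there y∈) px py)))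
  ... | no _ = count-≤1 P? xs u (λ x∈ y∈ → P-unique (there x∈) (there y∈))

  count-∪-≤ : (P? : Decidable P) (Q? : Decidable Q) (xs : List A) →
    count (P? ∪? Q?) xs ≤ count P? xs + count Q? xs
  count-∪-≤ P? Q? xs = subst (count (P? ∪? Q?) xs ≤_) (count-∪+count-∩ P? Q? xs) (m≤m+n _ _)

  count-∪-disjoint : (P? : Decidable P) (Q? : Decidable Q) (xs : List A) →
    (∀ {x} → x ∈ xs → P x → ¬ Q x) → count (P? ∪? Q?) xs ≡ count P? xs + count Q? xs
  count-∪-disjoint P? Q? xs P⇒¬Q = begin
    count (P? ∪? Q?) xs                              ≡⟨ sym (+-identityʳ _) ⟩
    count (P? ∪? Q?) xs + 0                          ≡⟨ cong (count (P? ∪? Q?) xs +_) (sym none) ⟩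
    count (P? ∪? Q?) xs + count (P? ∩? Q?) xs        ≡⟨ count-∪+count-∩ P? Q? xs ⟩
    count P? xs + count Q? xs                        ∎
    where
    open ≡-Reasoning
    none : count (P? ∩? Q?) xs ≡ 0
    none = count-none (P? ∩? Q?) xs (λ x∈ (p , q) → P⇒¬Q x∈ p q)

module _ {A B : Set} where

  map⁺-injectiveOn : {xs : List A} (f : A → B) →
    (∀ {x y} → x ∈ xs → y ∈ xs → f x ≡ f y → x ≡ y) → Unique xs → Unique (map f xs)
  map⁺-injectiveOn f inj [] = []
  map⁺-injectiveOn f inj (x∉ ∷ u) =
    All.map⁺ (All.tabulate λ y∈ fx≡fy → All.lookup x∉ y∈ (inj (here refl) (there y∈) fx≡fy))
    ∷ map⁺-injectiveOn f (λ x∈ y∈ → inj (there x∈) (there y∈)) u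

module _ {A : Set} where

  lookup-injective : {xs : List A} → Unique xs → {i j : Fin (length xs)} →
    lookup xs i ≡ lookup xs j → i ≡ j
  lookup-injective {_ ∷ _} _ {zero} {zero} _ = refl
  lookup-injective {_ ∷ _} (x∉ ∷ _) {zero} {suc j} x≡ = ⊥-elim (All.lookup x∉ (∈-lookup j) x≡)
  lookup-injective {_ ∷ _} (x∉ ∷ _) {suc i} {zero} ≡x = ⊥-elim (All.lookup x∉ (∈-lookup i) (sym ≡x))
  lookup-injective {_ ∷ _} (_ ∷ u) {suc i} {suc j} eq = cong suc (lookup-injective u eq)

  enumerate : ∀ {n} (xs : List A) → Unique xs → length xs ≡ n →
    Σ (Fin n → A) λ y → Injective _≡_ _≡_ y × (∀ i → y i ∈ xs) × (∀ {x} → x ∈ xs → ∃[ i ] y i ≡ x)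
  enumerate xs u refl =
    lookup xs , lookup-injective u , ∈-lookup , λ x∈ → index x∈ , sym (lookup-index x∈)

private
  variable
    a b c d u v w : ℕ
    e f : Edge
    x : ℕ

Ordered : Edge → Set
Ordered e = proj₁ e < proj₂ e

Incident : ℕ → Edge → Set
Incident v e = v ≡ proj₁ e ⊎ v ≡ proj₂ e

incident? : (v : ℕ) → Decidable (Incident v)
incident? v e = (v ≟ proj₁ e) ⊎-dec (v ≟ proj₂ e)

Joins : ℕ → ℕ → Edge → Set
Joins u v e = SamePair (proj₁ e) (proj₂ e) u v

joins? : (u v : ℕ) → Decidable (Joins u v)
joins? u v e = ((proj₁ e ≟ u) ×-dec (proj₂ e ≟ v)) ⊎-dec ((proj₁ e ≟ v) ×-dec (proj₂ e ≟ u))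

Meets : ℕ → ℕ → Edge → Set
Meets a b f = Incident a f ⊎ Incident b f

meets? : (a b : ℕ) → Decidable (Meets a b)
meets? a b = incident? a ∪? incident? b

joins-sym : Joins u v e → Joins v u e
joins-sym (inj₁ p) = inj₂ p
joins-sym (inj₂ p) = inj₁ p

joins⇒incident : Joins u v e → Incident u e
joins⇒incident (inj₁ (refl , _)) = inj₁ refl
joins⇒incident (inj₂ (_ , refl)) = inj₂ refl

incident⇒joins : u ≢ v → Incident u e → Incident v e → Joins u v e
incident⇒joins u≢v (inj₁ refl) (inj₁ refl) = ⊥-elim (u≢v refl)
incident⇒joins u≢v (inj₁ refl) (inj₂ refl) = inj₁ (refl , refl)
incident⇒joins u≢v (inj₂ refl) (inj₁ refl) = inj₂ (refl , refl)
incident⇒joins u≢v (inj₂ refl) (inj₂ refl) = ⊥-elim (u≢v refl)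

joins-endpoints : Joins u v e → Incident w e → w ≡ u ⊎ w ≡ v
joins-endpoints (inj₁ (refl , refl)) (inj₁ refl) = inj₁ refl
joins-endpoints (inj₁ (refl , refl)) (inj₂ refl) = inj₂ refl
joins-endpoints (inj₂ (refl , refl)) (inj₁ refl) = inj₂ refl
joins-endpoints (inj₂ (refl , refl)) (inj₂ refl) = inj₁ refl

joins-irrefl : Ordered e → ¬ Joins u u e
joins-irrefl lt (inj₁ (refl , refl)) = <-irrefl refl lt
joins-irrefl lt (inj₂ (refl , refl)) = <-irrefl refl lt

joins-injective : Ordered e → Ordered f → Joins u v e → Joins u v f → e ≡ f
joins-injective _  _   (inj₁ (refl , refl)) (inj₁ (refl , refl)) = refl
joins-injective lt lt′ (inj₁ (refl , refl)) (inj₂ (refl , refl)) = ⊥-elim (<-asym lt lt′)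
joins-injective lt lt′ (inj₂ (refl , refl)) (inj₁ (refl , refl)) = ⊥-elim (<-asym lt lt′)
joins-injective _  _   (inj₂ (refl , refl)) (inj₂ (refl , refl)) = refl

joins-functional : Ordered e → Joins u v e → Joins u w e → v ≡ w
joins-functional _  (inj₁ (refl , refl)) (inj₁ (refl , refl)) = refl
joins-functional lt (inj₁ (refl , refl)) (inj₂ (refl , refl)) = ⊥-elim (<-irrefl refl lt)
joins-functional lt (inj₂ (refl , refl)) (inj₁ (refl , refl)) = ⊥-elim (<-irrefl refl lt)
joins-functional _  (inj₂ (refl , refl)) (inj₂ (refl , refl)) = refl

opposite : ℕ → Edge → ℕ
opposite v (p , q) with p ≟ v
... | yes _ = q
... | no _ = p

joins-opposite : Incident v e → Joins v (opposite v e) e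
joins-opposite {v} {p , q} v∈e with p ≟ v
... | yes refl = inj₁ (refl , refl)
joins-opposite {v} {p , q} (inj₁ v≡p) | no p≢v = ⊥-elim (p≢v (sym v≡p))
joins-opposite {v} {p , q} (inj₂ refl) | no p≢v = inj₂ (refl , refl)

disjoint-incident : Disjoint e f → Incident v e → ¬ Incident v f
disjoint-incident (p≢c , _ , _ , _) (inj₁ refl) (inj₁ refl) = p≢c refl
disjoint-incident (_ , p≢d , _ , _) (inj₁ refl) (inj₂ refl) = p≢d refl
disjoint-incident (_ , _ , q≢c , _) (inj₂ refl) (inj₁ refl) = q≢c refl
disjoint-incident (_ , _ , _ , q≢d) (inj₂ refl) (inj₂ refl) = q≢d refl

disjoint⇒¬meets : Joins a b e → Disjoint e f → ¬ Meets a b f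
disjoint⇒¬meets ab∼e e#f (inj₁ a∈f) = disjoint-incident e#f (joins⇒incident ab∼e) a∈f
disjoint⇒¬meets ab∼e e#f (inj₂ b∈f) = disjoint-incident e#f (joins⇒incident (joins-sym ab∼e)) b∈f

¬meets⇒disjoint : Joins a b e → ¬ Meets a b f → Disjoint e f
¬meets⇒disjoint {e = p , q} {f} ab∼e ¬meets =
  avoid (inj₁ refl) (inj₁ refl) , avoid (inj₁ refl) (inj₂ refl) ,
  avoid (inj₂ refl) (inj₁ refl) , avoid (inj₂ refl) (inj₂ refl)
  where
  avoid : ∀ {v x} → Incident v (p , q) → Incident x f → v ≢ x
  avoid v∈e x∈f refl with joins-endpoints ab∼e v∈e
  ... | inj₁ refl = ¬meets (inj₁ x∈f)
  ... | inj₂ refl = ¬meets (inj₂ x∈f)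

CrossJoins : ℕ → ℕ → ℕ → ℕ → Edge → Set
CrossJoins a b c d f = (Joins a c f ⊎ Joins a d f) ⊎ (Joins b c f ⊎ Joins b d f)

crossJoins? : (a b c d : ℕ) → Decidable (CrossJoins a b c d)
crossJoins? a b c d = (joins? a c ∪? joins? a d) ∪? (joins? b c ∪? joins? b d)

meets-both⇒crossJoins : a ≢ c → a ≢ d → b ≢ c → b ≢ d →
  Meets a b f → Meets c d f → CrossJoins a b c d f
meets-both⇒crossJoins a≢c _ _ _ (inj₁ a∈f) (inj₁ c∈f) = inj₁ (inj₁ (incident⇒joins a≢c a∈f c∈f))
meets-both⇒crossJoins _ a≢d _ _ (inj₁ a∈f) (inj₂ d∈f) = inj₁ (inj₂ (incident⇒joins a≢d a∈f d∈f))
meets-both⇒crossJoins _ _ b≢c _ (inj₂ b∈f) (inj₁ c∈f) = inj₂ (inj₁ (incident⇒joins b≢c b∈f c∈f))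
meets-both⇒crossJoins _ _ _ b≢d (inj₂ b∈f) (inj₂ d∈f) = inj₂ (inj₂ (incident⇒joins b≢d b∈f d∈f))

module _ (G : Graph) where

  ordered-∈ : e ∈ edges G → Ordered e
  ordered-∈ = All.lookup (ordered G)

  Adj : ℕ → ℕ → Set
  Adj u v = Any (Joins u v) (edges G)

  adj? : (u v : ℕ) → Dec (Adj u v)
  adj? u v = any? (joins? u v) (edges G)

  adj-sym : Adj u v → Adj v u
  adj-sym = Any.map joins-sym

  adj⇒≢ : Adj u v → u ≢ v
  adj⇒≢ uv refl with find uv
  ... | _ , e∈ , uu∼e = joins-irrefl (ordered-∈ e∈) uu∼e

  adj⇒∈ : Adj u v → Ordered (a , b) → Joins u v (a , b) → (a , b) ∈ edges G
  adj⇒∈ uv a<b uv∼ab with find uv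
  ... | e , e∈ , uv∼e = subst (_∈ edges G) (joins-injective (ordered-∈ e∈) a<b uv∼e uv∼ab) e∈

  deg : ℕ → ℕ
  deg v = count (incident? v) (edges G)

  joinCount : ℕ → ℕ → ℕ
  joinCount u v = count (joins? u v) (edges G)

  joinCount≤1 : ∀ u v → joinCount u v ≤ 1
  joinCount≤1 u v = count-≤1 (joins? u v) (edges G) (distinct G)
    (λ e∈ f∈ → joins-injective (ordered-∈ e∈) (ordered-∈ f∈))

  joinCount-adj : Adj u v → joinCount u v ≡ 1
  joinCount-adj uv with find uv
  ... | _ , e∈ , uv∼e = ≤-antisym (joinCount≤1 _ _) (count-some (joins? _ _) (edges G) e∈ uv∼e)

  joinCount-¬adj : ¬ Adj u v → joinCount u v ≡ 0
  joinCount-¬adj ¬uv = count-none (joins? _ _) (edges G) (λ e∈ uv∼e → ¬uv (lose e∈ uv∼e))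

  joinCount⇒adj : 1 ≤ joinCount u v → Adj u v
  joinCount⇒adj pos with count-witness (joins? _ _) (edges G) pos
  ... | _ , e∈ , uv∼e = lose e∈ uv∼e

  meetCount : ℕ → ℕ → ℕ
  meetCount a b = count (meets? a b) (edges G)

  meetCount+1≡deg+deg : Adj a b → meetCount a b + 1 ≡ deg a + deg b
  meetCount+1≡deg+deg {a} {b} ab = begin
    meetCount a b + 1                                        ≡⟨ cong (meetCount a b +_) (sym both≡1) ⟩
    meetCount a b + count (incident? a ∩? incident? b) (edges G) ≡⟨ count-∪+count-∩ (incident? a) (incident? b) (edges G) ⟩
    deg a + deg b                                            ∎
    where
    open ≡-Reasoning
    both≡1 : count (incident? a ∩? incident? b) (edges G) ≡ 1
    both≡1 = trans (count-cong (incident? a ∩? incident? b) (joins? a b) (edges G)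
                      (λ _ (a∈ , b∈) → incident⇒joins (adj⇒≢ ab) a∈ b∈)
                      (λ _ ab∼ → joins⇒incident ab∼ , joins⇒incident (joins-sym ab∼)))
                   (joinCount-adj ab)

  disjointCount+meetCount : Joins a b e → count (disjoint? e) (edges G) + meetCount a b ≡ size G
  disjointCount+meetCount {a} {b} {e} ab∼e = begin
    count (disjoint? e) (edges G) + meetCount a b          ≡⟨ cong (_+ meetCount a b) disjoint≡¬meets ⟩
    count (∁? (meets? a b)) (edges G) + meetCount a b      ≡⟨ +-comm _ (meetCount a b) ⟩
    meetCount a b + count (∁? (meets? a b)) (edges G)      ≡⟨ count+count-∁ (meets? a b) (edges G) ⟩
    size G                                                 ∎
    where
    open ≡-Reasoning
    disjoint≡¬meets : count (disjoint? e) (edges G) ≡ count (∁? (meets? a b)) (edges G)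
    disjoint≡¬meets = count-cong (disjoint? e) (∁? (meets? a b)) (edges G)
      (λ _ → disjoint⇒¬meets ab∼e) (λ _ → ¬meets⇒disjoint ab∼e)

  ∈⇒adj : e ∈ edges G → Adj (proj₁ e) (proj₂ e)
  ∈⇒adj e∈ = lose e∈ (inj₁ (refl , refl))

  neighbours : ℕ → List ℕ
  neighbours u = map (opposite u) (filter (incident? u) (edges G))

  length-neighbours : ∀ u → length (neighbours u) ≡ deg u
  length-neighbours u = length-map (opposite u) (filter (incident? u) (edges G))

  ∈-neighbours⁻ : w ∈ neighbours u → Adj u w
  ∈-neighbours⁻ {u = u} w∈ with ∈-map⁻ (opposite u) w∈
  ... | e , e∈ , refl with ∈-filter⁻ (incident? u) {xs = edges G} e∈
  ... | e∈E , u∈e = lose e∈E (joins-opposite u∈e)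

  ∈-neighbours⁺ : Adj u w → w ∈ neighbours u
  ∈-neighbours⁺ {u} uw with find uw
  ... | e , e∈ , uw∼e =
    subst (_∈ neighbours u) (joins-functional (ordered-∈ e∈) (joins-opposite u∈e) uw∼e)
      (∈-map⁺ (opposite u) (∈-filter⁺ (incident? u) e∈ u∈e))
    where
    u∈e : Incident u e
    u∈e = joins⇒incident uw∼e

  neighbours-unique : ∀ u → Unique (neighbours u)
  neighbours-unique u = map⁺-injectiveOn (opposite u) opposite-injective
    (Unique.filter⁺ (incident? u) (distinct G))
    where
    opposite-injective : ∀ {e f} → e ∈ filter (incident? u) (edges G) → f ∈ filter (incident? u) (edges G) →
      opposite u e ≡ opposite u f → e ≡ f
    opposite-injective e∈ f∈ eq with ∈-filter⁻ (incident? u) {xs = edges G} e∈ | ∈-filter⁻ (incident? u) {xs = edges G} f∈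
    ... | e∈E , u∈e | f∈E , u∈f = joins-injective (ordered-∈ e∈E) (ordered-∈ f∈E)
      (subst (λ w → Joins u w _) eq (joins-opposite u∈e)) (joins-opposite u∈f)

  JoinsSome : ℕ → List ℕ → Edge → Set
  JoinsSome u ws e = Any (λ w → Joins u w e) ws

  joinsSome? : (u : ℕ) (ws : List ℕ) → Decidable (JoinsSome u ws)
  joinsSome? u ws e = any? (λ w → joins? u w e) ws

  count-joinsSome-∷ : ∀ u w ws →
    count (joinsSome? u (w ∷ ws)) (edges G) ≡ count (joins? u w ∪? joinsSome? u ws) (edges G)
  count-joinsSome-∷ u w ws =
    count-cong (joinsSome? u (w ∷ ws)) (joins? u w ∪? joinsSome? u ws) (edges G) (λ _ → toSum) (λ _ → fromSum)

  count-joinsSome-≤ : ∀ u ws → count (joinsSome? u ws) (edges G) ≤ length ws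
  count-joinsSome-≤ u [] = ≤-reflexive (count-none (joinsSome? u []) (edges G) (λ _ ()))
  count-joinsSome-≤ u (w ∷ ws) = begin
    count (joinsSome? u (w ∷ ws)) (edges G)                      ≡⟨ count-joinsSome-∷ u w ws ⟩
    count (joins? u w ∪? joinsSome? u ws) (edges G)              ≤⟨ count-∪-≤ (joins? u w) (joinsSome? u ws) (edges G) ⟩
    joinCount u w + count (joinsSome? u ws) (edges G)            ≤⟨ +-mono-≤ (joinCount≤1 u w) (count-joinsSome-≤ u ws) ⟩
    suc (length ws)                                              ∎
    where open ≤-Reasoning

  count-joinsSome-≡ : ∀ {u ws} → Unique ws → All (Adj u) ws → count (joinsSome? u ws) (edges G) ≡ length ws
  count-joinsSome-≡ {u} {[]} _ _ = count-none (joinsSome? u []) (edges G) (λ _ ())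
  count-joinsSome-≡ {u} {w ∷ ws} (w∉ ∷ uniq) (uw ∷ adjs) = begin
    count (joinsSome? u (w ∷ ws)) (edges G)                      ≡⟨ count-joinsSome-∷ u w ws ⟩
    count (joins? u w ∪? joinsSome? u ws) (edges G)              ≡⟨ count-∪-disjoint (joins? u w) (joinsSome? u ws) (edges G) w-fresh ⟩
    joinCount u w + count (joinsSome? u ws) (edges G)            ≡⟨ cong₂ _+_ (joinCount-adj uw) (count-joinsSome-≡ uniq adjs) ⟩
    suc (length ws)                                              ∎
    where
    open ≡-Reasoning
    w-fresh : ∀ {e} → e ∈ edges G → Joins u w e → ¬ JoinsSome u ws e
    w-fresh e∈ uw∼e joins with find joins
    ... | w′ , w′∈ , uw′∼e = All.lookup w∉ w′∈ (joins-functional (ordered-∈ e∈) uw∼e uw′∼e)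

  deg≤length : ∀ {u} ws → (∀ {w} → Adj u w → w ∈ ws) → deg u ≤ length ws
  deg≤length {u} ws nbrs = ≤-trans
    (count-mono (incident? u) (joinsSome? u ws) (edges G)
      (λ e∈ u∈e → lose (nbrs (lose e∈ (joins-opposite u∈e))) (joins-opposite u∈e)))
    (count-joinsSome-≤ u ws)

  length≤deg : ∀ {u ws} → Unique ws → All (Adj u) ws → length ws ≤ deg u
  length≤deg {u} {ws} uniq adjs = subst (_≤ deg u) (count-joinsSome-≡ uniq adjs)
    (count-mono (joinsSome? u ws) (incident? u) (edges G)
      (λ _ js → joins⇒incident (proj₂ (proj₂ (find js)))))

  deg≡length : ∀ {u ws} → Unique ws → All (Adj u) ws → (∀ {w} → Adj u w → w ∈ ws) → deg u ≡ length ws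
  deg≡length {ws = ws} uniq adjs nbrs = ≤-antisym (deg≤length ws nbrs) (length≤deg uniq adjs)

  star-centre-on-edge : All (Incident v) (edges G) → Adj x w → v ≡ x ⊎ v ≡ w
  star-centre-on-edge all xw with find xw
  ... | e , e∈ , xw∼e = joins-endpoints xw∼e (All.lookup all e∈)

  -- Two disjoint edges

  record DisjointEdges (a b c d : ℕ) : Set where
    field
      ab : Adj a b
      cd : Adj c d
      a≢c : a ≢ c
      a≢d : a ≢ d
      b≢c : b ≢ c
      b≢d : b ≢ d

  flipˡ : DisjointEdges a b c d → DisjointEdges b a c d
  flipˡ p = record { ab = adj-sym ab ; cd = cd ; a≢c = b≢c ; a≢d = b≢d ; b≢c = a≢c ; b≢d = a≢d }
    where open DisjointEdges p

  flipʳ : DisjointEdges a b c d → DisjointEdges a b d c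
  flipʳ p = record { ab = ab ; cd = adj-sym cd ; a≢c = a≢d ; a≢d = a≢c ; b≢c = b≢d ; b≢d = b≢c }
    where open DisjointEdges p

  swap-edges : DisjointEdges a b c d → DisjointEdges c d a b
  swap-edges p = record { ab = cd ; cd = ab ; a≢c = ≢-sym a≢c ; a≢d = ≢-sym b≢c ; b≢c = ≢-sym a≢d ; b≢d = ≢-sym b≢d }
    where open DisjointEdges p

  ∃DisjointEdges : Set
  ∃DisjointEdges = ∃[ a ] ∃[ b ] ∃[ c ] ∃[ d ] DisjointEdges a b c d

  avoiding⇒disjointEdges : Adj a b → f ∈ edges G → ¬ Meets a b f →
    DisjointEdges a b (proj₁ f) (proj₂ f)
  avoiding⇒disjointEdges ab f∈ ¬meets with ¬meets⇒disjoint (inj₁ (refl , refl)) ¬meets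
  ... | a≢c , a≢d , b≢c , b≢d =
    record { ab = ab ; cd = ∈⇒adj f∈ ; a≢c = a≢c ; a≢d = a≢d ; b≢c = b≢c ; b≢d = b≢d }

  triangle⇒disjointEdges : Adj a b → Adj b c → Adj a c → 4 ≤ size G → ∃DisjointEdges
  triangle⇒disjointEdges {a} {b} {c} ab bc ac 4≤m with count-witness (∁? triangle?) (edges G) outside
    where
    triangle? : Decidable (λ h → (Joins a b h ⊎ Joins b c h) ⊎ Joins a c h)
    triangle? = (joins? a b ∪? joins? b c) ∪? joins? a c
    outside : 1 ≤ count (∁? triangle?) (edges G)
    outside = +-cancelˡ-≤ 3 _ _ (begin
      4                                                          ≤⟨ 4≤m ⟩
      size G                                                     ≡⟨ sym (count+count-∁ triangle? (edges G)) ⟩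
      count triangle? (edges G) + count (∁? triangle?) (edges G) ≤⟨ +-monoˡ-≤ _ triangle≤3 ⟩
      3 + count (∁? triangle?) (edges G)                         ∎)
      where
      open ≤-Reasoning
      triangle≤3 : count triangle? (edges G) ≤ 3
      triangle≤3 = ≤-trans (count-∪-≤ _ _ (edges G)) (+-mono-≤
        (≤-trans (count-∪-≤ _ _ (edges G)) (+-mono-≤ (joinCount≤1 a b) (joinCount≤1 b c)))
        (joinCount≤1 a c))
  ... | h , h∈ , ¬tri with incident? a h | incident? b h | incident? c h
  ... | yes a∈h | _ | _ = a , opposite a h , b , c , record
    { ab = lose h∈ ax ; cd = bc ; a≢c = adj⇒≢ ab ; a≢d = adj⇒≢ ac
    ; b≢c = λ { refl → ¬tri (inj₁ (inj₁ ax)) } ; b≢d = λ { refl → ¬tri (inj₂ ax) } }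
    where
    ax : Joins a (opposite a h) h
    ax = joins-opposite a∈h
  ... | no a∉h | yes b∈h | _ = b , opposite b h , a , c , record
    { ab = lose h∈ bx ; cd = ac ; a≢c = ≢-sym (adj⇒≢ ab) ; a≢d = adj⇒≢ bc
    ; b≢c = λ { refl → a∉h (joins⇒incident (joins-sym bx)) } ; b≢d = λ { refl → ¬tri (inj₁ (inj₂ bx)) } }
    where
    bx : Joins b (opposite b h) h
    bx = joins-opposite b∈h
  ... | no a∉h | no b∉h | yes c∈h = c , opposite c h , a , b , record
    { ab = lose h∈ cx ; cd = ab ; a≢c = ≢-sym (adj⇒≢ ac) ; a≢d = ≢-sym (adj⇒≢ bc)
    ; b≢c = λ { refl → a∉h (joins⇒incident (joins-sym cx)) } ; b≢d = λ { refl → b∉h (joins⇒incident (joins-sym cx)) } }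
    where
    cx : Joins c (opposite c h) h
    cx = joins-opposite c∈h
  ... | no a∉h | no b∉h | no _ = _ , _ , _ , _ , avoiding⇒disjointEdges ab h∈ [ a∉h , b∉h ]

  module _ (¬star : ¬ IsStar G) where

    edge-avoiding : ∀ v → ∃[ e ] (e ∈ edges G × ¬ Incident v e)
    edge-avoiding v = find (¬All⇒Any¬ (incident? v) (edges G) (λ all → ¬star (v , all)))

    nonStar⇒disjointEdges : 4 ≤ size G → ∃DisjointEdges
    nonStar⇒disjointEdges 4≤m with edge-avoiding 0  -- just some edge
    ... | (a , b) , ab∈ , _ with edge-avoiding a
    ... | f , f∈ , a∉f with incident? b f
    ... | no b∉f = _ , _ , _ , _ , avoiding⇒disjointEdges (∈⇒adj ab∈) f∈ [ a∉f , b∉f ]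
    ... | yes b∈f with edge-avoiding b
    ... | g , g∈ , b∉g with incident? a g
    ... | no a∉g = _ , _ , _ , _ , avoiding⇒disjointEdges (∈⇒adj ab∈) g∈ [ a∉g , b∉g ]
    ... | yes a∈g with opposite b f ≟ opposite a g
    ... | no x≢y = b , opposite b f , a , opposite a g , record
      { ab = lose f∈ bx ; cd = lose g∈ ay ; a≢c = ≢-sym (adj⇒≢ (∈⇒adj ab∈))
      ; a≢d = λ { refl → b∉g (joins⇒incident (joins-sym ay)) }
      ; b≢c = λ { refl → a∉f (joins⇒incident (joins-sym bx)) } ; b≢d = x≢y }
      where
      bx : Joins b (opposite b f) f
      bx = joins-opposite b∈f
      ay : Joins a (opposite a g) g
      ay = joins-opposite a∈g
    ... | yes x≡y = triangle⇒disjointEdges (∈⇒adj ab∈) (lose f∈ (joins-opposite b∈f))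
      (subst (Adj a) (sym x≡y) (lose g∈ (joins-opposite a∈g))) 4≤m

  k4-pair : Adj a b → Adj c d → Adj a c → Adj a d → Adj b c → Adj b d → DisjointEdges a b c d
  k4-pair ab cd ac ad bc bd =
    record { ab = ab ; cd = cd ; a≢c = adj⇒≢ ac ; a≢d = adj⇒≢ ad ; b≢c = adj⇒≢ bc ; b≢d = adj⇒≢ bd }

  -- The book graph K₂ + E_n, with spine pq and the n pages ws.
  record Book (p q : ℕ) (ws : List ℕ) : Set where
    field
      spine : Adj p q
      pages-unique : Unique ws
      p-pages : All (Adj p) ws
      q-pages : All (Adj q) ws
      p∉pages : p ∉ ws
      q∉pages : q ∉ ws
      edge-cases : e ∈ edges G → Joins p q e ⊎ (JoinsSome p ws e ⊎ JoinsSome q ws e)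

  module _ {p q ws} (B : Book p q ws) where
    open Book B

    book-swap : Book q p ws
    book-swap = record
      { spine = adj-sym spine ; pages-unique = pages-unique ; p-pages = q-pages ; q-pages = p-pages
      ; p∉pages = q∉pages ; q∉pages = p∉pages
      ; edge-cases = λ e∈ → case edge-cases e∈ of λ where
          (inj₁ pq∼e) → inj₁ (joins-sym pq∼e)
          (inj₂ (inj₁ js)) → inj₂ (inj₂ js)
          (inj₂ (inj₂ js)) → inj₂ (inj₁ js) }

    spine-meets-all : e ∈ edges G → Meets p q e
    spine-meets-all e∈ with edge-cases e∈
    ... | inj₁ pq∼e = inj₁ (joins⇒incident pq∼e)
    ... | inj₂ (inj₁ js) = inj₁ (joins⇒incident (proj₂ (proj₂ (find js))))
    ... | inj₂ (inj₂ js) = inj₂ (joins⇒incident (proj₂ (proj₂ (find js))))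

    spine-neighbour : Adj p x → x ∈ q ∷ ws
    spine-neighbour px with find px
    ... | e , e∈ , px∼e with edge-cases e∈
    ... | inj₁ pq∼e = here (joins-functional (ordered-∈ e∈) px∼e pq∼e)
    ... | inj₂ (inj₁ js) = let w , w∈ , pw∼e = find js in
      there (subst (_∈ ws) (joins-functional (ordered-∈ e∈) pw∼e px∼e) w∈)
    ... | inj₂ (inj₂ js) with find js
    ...   | w , w∈ , qw∼e with joins-endpoints qw∼e (joins⇒incident px∼e)
    ...     | inj₁ refl = ⊥-elim (adj⇒≢ spine refl)
    ...     | inj₂ refl = ⊥-elim (p∉pages w∈)

    deg-spine : deg p ≡ suc (length ws)
    deg-spine = deg≡length (¬Any⇒All¬ ws q∉pages ∷ pages-unique) (spine ∷ p-pages) spine-neighbour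

  module _ {p q ws} (B : Book p q ws) where
    open Book B

    book-size : size G ≡ 2 * length ws + 1
    book-size = book-size-arith (begin
      size G + 1             ≡⟨ cong (_+ 1) (sym (count-all (meets? p q) (edges G) (spine-meets-all B))) ⟩
      meetCount p q + 1      ≡⟨ meetCount+1≡deg+deg spine ⟩
      deg p + deg q          ≡⟨ cong₂ _+_ (deg-spine B) (deg-spine (book-swap B)) ⟩
      suc (length ws) + suc (length ws) ∎)
      where open ≡-Reasoning

    page-edge-disjointCount : ∀ {s} → length ws ≡ suc s → e ∈ edges G → JoinsSome p ws e →
      count (disjoint? e) (edges G) ≤ s
    page-edge-disjointCount {e} len e∈ js with find js
    ... | w , w∈ , pw∼e = book-page-arith (trans (disjointCount+meetCount pw∼e) book-size)
      (subst (suc (length ws) + 2 ≤_) (sym (meetCount+1≡deg+deg pw))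
        (+-mono-≤ (≤-reflexive (sym (deg-spine B))) deg-page)) len
      where
      pw : Adj p w
      pw = All.lookup p-pages w∈
      deg-page : 2 ≤ deg w
      deg-page = length≤deg ((adj⇒≢ spine ∷ []) ∷ [] ∷ [])
        (adj-sym pw ∷ adj-sym (All.lookup q-pages w∈) ∷ [])

  book-almostIntersecting : ∀ {s p q ws} → Book p q ws → length ws ≡ suc s → AlmostIntersecting s G
  book-almostIntersecting {s} B len = All.tabulate λ {e} e∈ → case edge-cases e∈ of λ where
      (inj₁ pq∼e) → subst (_≤ s) (sym (spine-disjointCount pq∼e)) z≤n
      (inj₂ (inj₁ js)) → page-edge-disjointCount B len e∈ js
      (inj₂ (inj₂ js)) → page-edge-disjointCount (book-swap B) len e∈ js
    where
    open Book B
    spine-disjointCount : Joins _ _ e → count (disjoint? e) (edges G) ≡ 0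
    spine-disjointCount pq∼e = count-none (disjoint? _) (edges G)
      (λ f∈ e#f → disjoint⇒¬meets pq∼e e#f (spine-meets-all B f∈))

  module _ {p q w ws} (B : Book p q (w ∷ ws)) where
    open Book B

    book-¬star : ¬ IsStar G
    book-¬star (v , all) with star-centre-on-edge all spine
    ... | inj₁ refl = [ adj⇒≢ spine , p∉pages ∘ here ] (star-centre-on-edge all (All.head q-pages))
    ... | inj₂ refl = [ adj⇒≢ (adj-sym spine) , q∉pages ∘ here ] (star-centre-on-edge all (All.head p-pages))

  book⇒K2+E : ∀ {s p q ws} → Book p q ws → length ws ≡ suc s → IsK2PlusE s G
  book⇒K2+E {s} {p} {q} {ws} B len with enumerate ws (Book.pages-unique B) len
  ... | y , y-inj , y∈ , y-onto =
    p , q , y , adj⇒≢ spine , y-inj , (λ i → y≢ p∉pages i , y≢ q∉pages i) , λ u v → mk⇔ to (from u v)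
    where
    open Book B
    y≢ : ∀ {x} → x ∉ ws → ∀ i → y i ≢ x
    y≢ x∉ i refl = x∉ (y∈ i)
    page-index : ∀ {x e} → JoinsSome x ws e → ∃[ i ] Joins x (y i) e
    page-index js with find js
    ... | w , w∈ , xw∼e with y-onto w∈
    ...   | i , refl = i , xw∼e
    to : ∀ {u v} → (u , v) ∈ edges G → u < v × AdjK2E s p q y u v
    to e∈ with edge-cases e∈
    ... | inj₁ pq∼e = ordered-∈ e∈ , inj₁ pq∼e
    ... | inj₂ (inj₁ js) = let i , py∼e = page-index js in ordered-∈ e∈ , inj₂ (i , inj₁ py∼e)
    ... | inj₂ (inj₂ js) = let i , qy∼e = page-index js in ordered-∈ e∈ , inj₂ (i , inj₂ qy∼e)
    from : ∀ u v → u < v × AdjK2E s p q y u v → (u , v) ∈ edges G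
    from u v (u<v , inj₁ pq∼e) = adj⇒∈ spine u<v pq∼e
    from u v (u<v , inj₂ (i , inj₁ py∼e)) = adj⇒∈ (All.lookup p-pages (y∈ i)) u<v py∼e
    from u v (u<v , inj₂ (i , inj₂ qy∼e)) = adj⇒∈ (All.lookup q-pages (y∈ i)) u<v qy∼e

  K2+E⇒book : ∀ {s} → IsK2PlusE s G → ∃[ p ] ∃[ q ] Σ (Fin (suc s) → ℕ) λ y → Book p q (tabulate y)
  K2+E⇒book {s} (x₁ , x₂ , y , x₁≢x₂ , y-inj , y≢ , edges⇔) = x₁ , x₂ , y , record
    { spine = adj-from-K2E x₁≢x₂ inj₁
    ; pages-unique = Unique.tabulate⁺ y-inj
    ; p-pages = All.tabulate⁺ λ i → adj-from-K2E (≢-sym (proj₁ (y≢ i))) (λ x₁y → inj₂ (i , inj₁ x₁y))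
    ; q-pages = All.tabulate⁺ λ i → adj-from-K2E (≢-sym (proj₂ (y≢ i))) (λ x₂y → inj₂ (i , inj₂ x₂y))
    ; p∉pages = λ x₁∈ → let i , x₁≡ = ∈-tabulate⁻ {f = y} x₁∈ in proj₁ (y≢ i) (sym x₁≡)
    ; q∉pages = λ x₂∈ → let i , x₂≡ = ∈-tabulate⁻ {f = y} x₂∈ in proj₂ (y≢ i) (sym x₂≡)
    ; edge-cases = cases
    }
    where
    adj-from-K2E : ∀ {u v} → u ≢ v → (∀ {a b} → SamePair a b u v → AdjK2E s x₁ x₂ y a b) → Adj u v
    adj-from-K2E {u} {v} u≢v adjK2E with <-cmp u v
    ... | tri< u<v _ _ = lose (Equivalence.from (edges⇔ u v) (u<v , adjK2E (inj₁ (refl , refl)))) (inj₁ (refl , refl))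
    ... | tri≈ _ u≡v _ = ⊥-elim (u≢v u≡v)
    ... | tri> _ _ v<u = lose (Equivalence.from (edges⇔ v u) (v<u , adjK2E (inj₂ (refl , refl)))) (inj₂ (refl , refl))
    cases : ∀ {e} → e ∈ edges G → Joins x₁ x₂ e ⊎ (JoinsSome x₁ (tabulate y) e ⊎ JoinsSome x₂ (tabulate y) e)
    cases {a , b} e∈ with proj₂ (Equivalence.to (edges⇔ a b) e∈)
    ... | inj₁ x₁x₂∼e = inj₁ x₁x₂∼e
    ... | inj₂ (i , inj₁ x₁y∼e) = inj₂ (inj₁ (lose (∈-tabulate⁺ {f = y} i) x₁y∼e))
    ... | inj₂ (i , inj₂ x₂y∼e) = inj₂ (inj₂ (lose (∈-tabulate⁺ {f = y} i) x₂y∼e))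

  -- K₄ minus the edge bd, with hubs a, c and rims b, d.
  record Diamond (a b c d : ℕ) : Set where
    field
      ac : Adj a c
      ab : Adj a b
      ad : Adj a d
      cb : Adj c b
      cd : Adj c d
      ¬bd : ¬ Adj b d
      b≢d : b ≢ d

  swap-hubs : Diamond a b c d → Diamond c b a d
  swap-hubs D = record { ac = adj-sym ac ; ab = cb ; ad = cd ; cb = ab ; cd = ad ; ¬bd = ¬bd ; b≢d = b≢d }
    where open Diamond D

  -- Almost intersecting graphs

  module _ {s : ℕ} (ai : AlmostIntersecting s G) where

    size≤s+meetCount : Adj a b → size G ≤ s + meetCount a b
    size≤s+meetCount {a} {b} ab with find ab
    ... | e , e∈ , ab∼e = begin
      size G                                         ≡⟨ sym (disjointCount+meetCount ab∼e) ⟩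
      count (disjoint? e) (edges G) + meetCount a b  ≤⟨ +-monoˡ-≤ (meetCount a b) (All.lookup ai e∈) ⟩
      s + meetCount a b                              ∎
      where open ≤-Reasoning

    size+1≤s+deg+deg : Adj a b → size G + 1 ≤ s + (deg a + deg b)
    size+1≤s+deg+deg {a} {b} ab = begin
      size G + 1                ≤⟨ +-monoˡ-≤ 1 (size≤s+meetCount ab) ⟩
      s + meetCount a b + 1     ≡⟨ +-assoc s (meetCount a b) 1 ⟩
      s + (meetCount a b + 1)   ≡⟨ cong (s +_) (meetCount+1≡deg+deg ab) ⟩
      s + (deg a + deg b)       ∎
      where open ≤-Reasoning

    module _ (big : 2 * s + 3 ≤ size G) where

      module _ {a b c d} (p : DisjointEdges a b c d) where
        open DisjointEdges p

        private
          meets-either? : Decidable (λ f → Meets a b f ⊎ Meets c d f)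
          meets-either? = meets? a b ∪? meets? c d
          meets-both? : Decidable (λ f → Meets a b f × Meets c d f)
          meets-both? = meets? a b ∩? meets? c d
          missCount bothCount : ℕ
          missCount = count (∁? meets-either?) (edges G)
          bothCount = count meets-both? (edges G)
          u+i≡x+y : count meets-either? (edges G) + bothCount ≡ meetCount a b + meetCount c d
          u+i≡x+y = count-∪+count-∩ (meets? a b) (meets? c d) (edges G)
          u+n≡m : count meets-either? (edges G) + missCount ≡ size G
          u+n≡m = count+count-∁ meets-either? (edges G)

        crossCount : ℕ
        crossCount = (joinCount a c + joinCount a d) + (joinCount b c + joinCount b d)

        bothCount≤crossCount : bothCount ≤ crossCount
        bothCount≤crossCount = ≤-trans
          (count-mono meets-both? (crossJoins? a b c d) (edges G)
            (λ _ (ab-meets , cd-meets) → meets-both⇒crossJoins a≢c a≢d b≢c b≢d ab-meets cd-meets))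
          (≤-trans (count-∪-≤ _ _ (edges G)) (+-mono-≤ (count-∪-≤ _ _ (edges G)) (count-∪-≤ _ _ (edges G))))

        crossCount≤4 : crossCount ≤ 4
        crossCount≤4 = +-mono-≤ (+-mono-≤ (joinCount≤1 a c) (joinCount≤1 a d))
                                (+-mono-≤ (joinCount≤1 b c) (joinCount≤1 b d))

        missCount+3≤bothCount : missCount + 3 ≤ bothCount
        missCount+3≤bothCount =
          both-count-arith {s = s} {x = meetCount a b} {y = meetCount c d} u+i≡x+y u+n≡m (size≤s+meetCount cd) (size≤s+meetCount ab) big

        three-crossJoins : 3 ≤ crossCount
        three-crossJoins = ≤-trans (m≤n+m 3 missCount) (≤-trans missCount+3≤bothCount bothCount≤crossCount)

        missCount≤1 : missCount ≤ 1
        missCount≤1 = +-cancelʳ-≤ 3 missCount 1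
          (≤-trans missCount+3≤bothCount (≤-trans bothCount≤crossCount crossCount≤4))

        deg+deg≤s+5 : deg a + deg b ≤ s + 5
        deg+deg≤s+5 = begin
          deg a + deg b         ≡⟨ sym (meetCount+1≡deg+deg ab) ⟩
          meetCount a b + 1     ≤⟨ +-monoˡ-≤ 1 meetCount≤s+4 ⟩
          s + 4 + 1             ≡⟨ +-assoc s 4 1 ⟩
          s + 5                 ∎
          where
          open ≤-Reasoning
          meetCount≤s+4 : meetCount a b ≤ s + 4
          meetCount≤s+4 = meet-count-arith {s = s} {x = meetCount a b} {y = meetCount c d} u+i≡x+y u+n≡m (size≤s+meetCount cd)
            (≤-trans bothCount≤crossCount crossCount≤4)

        outside-deg≤5 : w ≢ a → w ≢ b → w ≢ c → w ≢ d → deg w ≤ 5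
        outside-deg≤5 {w} w≢a w≢b w≢c w≢d = ≤-trans
          (count-mono (incident? w) (joinsSome? w abcd ∪? ∁? meets-either?) (edges G) classify)
          (≤-trans (count-∪-≤ _ _ (edges G)) (+-mono-≤ (count-joinsSome-≤ w abcd) missCount≤1))
          where
          abcd : List ℕ
          abcd = a ∷ b ∷ c ∷ d ∷ []
          classify : ∀ {e} → e ∈ edges G → Incident w e → JoinsSome w abcd e ⊎ ¬ (Meets a b e ⊎ Meets c d e)
          classify {e} _ w∈e with meets-either? e
          ... | no ¬meets = inj₂ ¬meets
          ... | yes (inj₁ (inj₁ a∈e)) = inj₁ (here (incident⇒joins w≢a w∈e a∈e))
          ... | yes (inj₁ (inj₂ b∈e)) = inj₁ (there (here (incident⇒joins w≢b w∈e b∈e)))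
          ... | yes (inj₂ (inj₁ c∈e)) = inj₁ (there (there (here (incident⇒joins w≢c w∈e c∈e))))
          ... | yes (inj₂ (inj₂ d∈e)) = inj₁ (there (there (there (here (incident⇒joins w≢d w∈e d∈e)))))

      missing-cross : DisjointEdges a b c d → ¬ Adj a c → Adj a d × Adj b c × Adj b d
      missing-cross {a} {b} {c} {d} p ¬ac
        with three-bits-set (joinCount≤1 a d) (joinCount≤1 b c) (joinCount≤1 b d)
               (subst (λ k → 3 ≤ k + joinCount a d + (joinCount b c + joinCount b d))
                      (joinCount-¬adj ¬ac) (three-crossJoins p))
      ... | ad , bc , bd = joinCount⇒adj ad , joinCount⇒adj bc , joinCount⇒adj bd

      low-or-high : DisjointEdges a b c d → deg a ≤ 3 ⊎ size G + 1 ≤ s + (deg a + 5)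
      low-or-high {a} {b} {c} {d} p with All.all? (_∈? b ∷ c ∷ d ∷ []) (neighbours a)
      ... | yes inside = inj₁ (deg≤length (b ∷ c ∷ d ∷ []) (λ aw → All.lookup inside (∈-neighbours⁺ aw)))
      ... | no ¬inside with find (¬All⇒Any¬ (_∈? b ∷ c ∷ d ∷ []) (neighbours a) ¬inside)
      ...   | w , w∈ , w∉ = inj₂ (≤-trans (size+1≤s+deg+deg aw)
                (+-monoʳ-≤ s (+-monoʳ-≤ (deg a) (outside-deg≤5 p w≢a w≢b w≢c w≢d))))
        where
        aw : Adj a w
        aw = ∈-neighbours⁻ w∈
        w≢a : w ≢ a
        w≢a = ≢-sym (adj⇒≢ aw)
        w≢b : w ≢ b
        w≢b = w∉ ∘ here
        w≢c : w ≢ c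
        w≢c = w∉ ∘ there ∘ here
        w≢d : w ≢ d
        w≢d = w∉ ∘ there ∘ there ∘ here

      module _ (8≤s : 8 ≤ s) where

        adjacent-low-degrees : Adj u v → deg u ≤ 3 → deg v ≤ 3 → ⊥
        adjacent-low-degrees uv u-low v-low =
          <⇒≱ 8≤s (≤-trans (k4-low-arith (size+1≤s+deg+deg uv) u-low v-low big) (m≤m+n 2 5))

        disjoint-high-degrees : DisjointEdges a b c d →
          size G + 1 ≤ s + (deg a + 5) → size G + 1 ≤ s + (deg b + 5) → ⊥
        disjoint-high-degrees p a-high b-high = <⇒≱ 8≤s (k4-high-arith a-high b-high (deg+deg≤s+5 p) big)

        no-K4 : Adj a b → Adj a c → Adj a d → Adj b c → Adj b d → Adj c d → ⊥
        -- Two of a, b, c are both low or both high.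
        no-K4 ab ac ad bc bd cd
          with low-or-high (k4-pair ab cd ac ad bc bd)
             | low-or-high (flipˡ (k4-pair ab cd ac ad bc bd))
             | low-or-high (swap-edges (k4-pair ab cd ac ad bc bd))
        ... | inj₁ a-low  | inj₁ b-low  | _           = adjacent-low-degrees ab a-low b-low
        ... | inj₂ a-high | inj₂ b-high | _           = disjoint-high-degrees (k4-pair ab cd ac ad bc bd) a-high b-high
        ... | inj₁ a-low  | inj₂ _      | inj₁ c-low  = adjacent-low-degrees ac a-low c-low
        ... | inj₁ _      | inj₂ b-high | inj₂ c-high =
          disjoint-high-degrees (k4-pair bc ad (adj-sym ab) bd (adj-sym ac) cd) b-high c-high
        ... | inj₂ _      | inj₁ b-low  | inj₁ c-low  = adjacent-low-degrees bc b-low c-low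
        ... | inj₂ a-high | inj₁ _      | inj₂ c-high =
          disjoint-high-degrees (k4-pair ac bd ab ad (adj-sym bc) cd) a-high c-high

        module _ {a b c d} (D : Diamond a b c d) where
          open Diamond D

          rim-neighbour : Adj b w → w ≡ a ⊎ w ≡ c
          rim-neighbour {w} bw with w ≟ a | w ≟ c
          ... | yes w≡a | _ = inj₁ w≡a
          ... | no _ | yes w≡c = inj₂ w≡c
          -- Otherwise the crossings of bw with dc and with da make a, b, c, w a K₄.
          ... | no w≢a | no w≢c = ⊥-elim (no-K4 ab ac (adj-sym wa) (adj-sym cb) bw (adj-sym wc))
            where
            w≢d : w ≢ d
            w≢d refl = ¬bd bw
            bw-dc : DisjointEdges b w d c
            bw-dc = record { ab = bw ; cd = adj-sym cd ; a≢c = b≢d ; a≢d = ≢-sym (adj⇒≢ cb)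
                           ; b≢c = w≢d ; b≢d = w≢c }
            bw-da : DisjointEdges b w d a
            bw-da = record { ab = bw ; cd = adj-sym ad ; a≢c = b≢d ; a≢d = ≢-sym (adj⇒≢ ab)
                           ; b≢c = w≢d ; b≢d = w≢a }
            wc : Adj w c
            wc = proj₂ (proj₂ (missing-cross bw-dc ¬bd))
            wa : Adj w a
            wa = proj₂ (proj₂ (missing-cross bw-da ¬bd))

          hub-neighbour : Adj a w → w ≢ c → Adj c w
          hub-neighbour {w} aw w≢c with w ≟ b
          ... | yes refl = cb
          ... | no w≢b = adj-sym (proj₁ (missing-cross wa-bc ¬wb))
            where
            wa-bc : DisjointEdges w a b c
            wa-bc = record { ab = adj-sym aw ; cd = adj-sym cb ; a≢c = w≢b ; a≢d = w≢c
                           ; b≢c = adj⇒≢ ab ; b≢d = adj⇒≢ ac }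
            ¬wb : ¬ Adj w b
            ¬wb wb = [ ≢-sym (adj⇒≢ aw) , w≢c ] (rim-neighbour (adj-sym wb))

          hubs-cover : e ∈ edges G → Meets a c e
          hubs-cover {x , y} e∈ with incident? a (x , y) | incident? c (x , y)
          ... | yes a∈e | _ = inj₁ a∈e
          ... | no _ | yes c∈e = inj₂ c∈e
          ... | no a∉e | no c∉e = ⊥-elim (avoid (x ≟ b) (y ≟ b))
            where
            ¬b-adj : ∀ {v} → Incident v (x , y) → ¬ Adj b v
            ¬b-adj v∈e bv = [ (λ { refl → a∉e v∈e }) , (λ { refl → c∉e v∈e }) ] (rim-neighbour bv)
            avoid : Dec (x ≡ b) → Dec (y ≡ b) → ⊥
            avoid (yes refl) _ = ¬b-adj (inj₂ refl) (∈⇒adj e∈)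
            avoid (no _) (yes refl) = ¬b-adj (inj₁ refl) (adj-sym (∈⇒adj e∈))
            avoid (no x≢b) (no y≢b) = ¬b-adj (inj₂ refl) (adj-sym (proj₁ (proj₂ (missing-cross xy-ba ¬xb))))
              where
              xy-ba : DisjointEdges x y b a
              xy-ba = record { ab = ∈⇒adj e∈ ; cd = adj-sym ab ; a≢c = x≢b ; a≢d = λ { refl → a∉e (inj₁ refl) }
                             ; b≢c = y≢b ; b≢d = λ { refl → a∉e (inj₂ refl) } }
              ¬xb : ¬ Adj x b
              ¬xb = ¬b-adj (inj₁ refl) ∘ adj-sym

          hubs-degree-sum : size G + 1 ≡ deg a + deg c
          hubs-degree-sum = trans (cong (_+ 1) (sym (count-all (meets? a c) (edges G) hubs-cover)))
                                  (meetCount+1≡deg+deg ac)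

          rim-deg≤2 : deg b ≤ 2
          rim-deg≤2 = deg≤length (a ∷ c ∷ []) (λ bw → [ (λ { refl → here refl }) , (λ { refl → there (here refl) }) ] (rim-neighbour bw))

          hub-deg≤s+2 : deg c ≤ s + 2
          hub-deg≤s+2 = diamond-hub-arith hubs-degree-sum (size+1≤s+deg+deg ab) rim-deg≤2

        diamond-hub-deg : Diamond a b c d → deg a ≡ s + 2
        diamond-hub-deg D = diamond-hubs-arith (hubs-degree-sum D) (hub-deg≤s+2 (swap-hubs D)) (hub-deg≤s+2 D) big

        module _ {a b c d} (D : Diamond a b c d) where
          open Diamond D

          pages : List ℕ
          pages = filter (∁? (_≟ c)) (neighbours a)

          length-pages : length pages ≡ suc s
          length-pages = suc-injective (begin
            suc (length pages)                                  ≡⟨ cong (_+ length pages) c-once ⟩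
            count (_≟ c) (neighbours a) + length pages          ≡⟨ count+count-∁ (_≟ c) (neighbours a) ⟩
            length (neighbours a)                               ≡⟨ length-neighbours a ⟩
            deg a                                               ≡⟨ diamond-hub-deg D ⟩
            s + 2                                               ≡⟨ +-comm s 2 ⟩
            suc (suc s)                                         ∎)
            where
            open ≡-Reasoning
            c-once : 1 ≡ count (_≟ c) (neighbours a)
            c-once = ≤-antisym (count-some (_≟ c) (neighbours a) (∈-neighbours⁺ ac) refl)
              (count-≤1 (_≟ c) (neighbours a) (neighbours-unique a) (λ _ _ x≡c y≡c → trans x≡c (sym y≡c)))

          ∈-pages : Adj a w → w ≢ c → w ∈ pages
          ∈-pages aw w≢c = ∈-filter⁺ (∁? (_≟ c)) (∈-neighbours⁺ aw) w≢c

          diamond⇒book : Book a c pages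
          diamond⇒book = record
            { spine = ac
            ; pages-unique = Unique.filter⁺ (∁? (_≟ c)) (neighbours-unique a)
            ; p-pages = All.tabulate (λ w∈ → ∈-neighbours⁻ (proj₁ (∈-filter⁻ (∁? (_≟ c)) {xs = neighbours a} w∈)))
            ; q-pages = All.tabulate (λ w∈ → let w∈N , w≢c = ∈-filter⁻ (∁? (_≟ c)) {xs = neighbours a} w∈ in
                                               hub-neighbour D (∈-neighbours⁻ w∈N) w≢c)
            ; p∉pages = λ a∈ → adj⇒≢ (∈-neighbours⁻ (proj₁ (∈-filter⁻ (∁? (_≟ c)) {xs = neighbours a} a∈))) refl
            ; q∉pages = λ c∈ → proj₂ (∈-filter⁻ (∁? (_≟ c)) {xs = neighbours a} c∈) refl
            ; edge-cases = cases
            }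
            where
            cases : e ∈ edges G → Joins a c e ⊎ (JoinsSome a pages e ⊎ JoinsSome c pages e)
            cases {e} e∈ with hubs-cover D e∈ | incident? a e | incident? c e
            ... | _ | yes a∈e | yes c∈e = inj₁ (incident⇒joins (adj⇒≢ ac) a∈e c∈e)
            ... | _ | yes a∈e | no c∉e = inj₂ (inj₁ (lose (∈-pages (lose e∈ ax) x≢c) ax))
              where
              ax : Joins a (opposite a e) e
              ax = joins-opposite a∈e
              x≢c : opposite a e ≢ c
              x≢c refl = c∉e (joins⇒incident (joins-sym ax))
            ... | _ | no a∉e | yes c∈e = inj₂ (inj₂ (lose (∈-pages (hub-neighbour (swap-hubs D) cx x≢a) x≢c) (joins-opposite c∈e)))
              where
              cx : Adj c (opposite c e)
              cx = lose e∈ (joins-opposite c∈e)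
              x≢a : opposite c e ≢ a
              x≢a refl = a∉e (joins⇒incident (joins-sym (joins-opposite c∈e)))
              x≢c : opposite c e ≢ c
              x≢c = ≢-sym (adj⇒≢ cx)
            ... | inj₁ a∈e | no a∉e | no _ = ⊥-elim (a∉e a∈e)
            ... | inj₂ c∈e | no _ | no c∉e = ⊥-elim (c∉e c∈e)

        diamond⇒K2+E : Diamond a b c d → IsK2PlusE s G
        diamond⇒K2+E D = book⇒K2+E (diamond⇒book D) (length-pages D)

        missing⇒diamond : DisjointEdges a b c d → ¬ Adj a c → Diamond b a d c
        missing⇒diamond {a} {b} {c} {d} p ¬ac = record
          { ac = bd ; ab = adj-sym ab ; ad = bc ; cb = adj-sym ad ; cd = adj-sym cd ; ¬bd = ¬ac ; b≢d = a≢c }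
          where
          open DisjointEdges p
          crosses : Adj a d × Adj b c × Adj b d
          crosses = missing-cross p ¬ac
          ad : Adj a d
          ad = proj₁ crosses
          bc : Adj b c
          bc = proj₁ (proj₂ crosses)
          bd : Adj b d
          bd = proj₂ (proj₂ crosses)

        disjointEdges⇒K2+E : DisjointEdges a b c d → IsK2PlusE s G
        disjointEdges⇒K2+E {a} {b} {c} {d} p with adj? a c | adj? a d | adj? b c | adj? b d
        ... | no ¬ac | _     | _      | _      = diamond⇒K2+E (missing⇒diamond p ¬ac)
        ... | yes _  | no ¬ad | _     | _      = diamond⇒K2+E (missing⇒diamond (flipʳ p) ¬ad)
        ... | yes _  | yes _ | no ¬bc | _      = diamond⇒K2+E (missing⇒diamond (flipˡ p) ¬bc)
        ... | yes _  | yes _ | yes _  | no ¬bd = diamond⇒K2+E (missing⇒diamond (flipˡ (flipʳ p)) ¬bd)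
        ... | yes ac | yes ad | yes bc | yes bd = ⊥-elim (no-K4 (DisjointEdges.ab p) ac ad bc bd (DisjointEdges.cd p))

large-nonStar⇒K2+E : ∀ {s} G → 8 ≤ s → AlmostIntersecting s G → ¬ IsStar G → 2 * s + 3 ≤ size G →
  IsK2PlusE s G
large-nonStar⇒K2+E G 8≤s ai ¬star big
  with nonStar⇒disjointEdges G ¬star (≤-trans (4≤2s+3 (≤-trans (s≤s z≤n) 8≤s)) big)
... | _ , _ , _ , _ , p = disjointEdges⇒K2+E G ai big 8≤s p

K2+E⇒properties : ∀ {s} G → IsK2PlusE s G → AlmostIntersecting s G × ¬ IsStar G × size G ≡ 2 * s + 3
K2+E⇒properties {s} G k with K2+E⇒book G k
... | _ , _ , y , B =
  book-almostIntersecting G B (length-tabulate y) ,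
  book-¬star G B ,
  trans (book-size G B) (trans (cong (λ n → 2 * n + 1) (length-tabulate y)) (size-of-K2+E s))

theorem4p2 : (s : ℕ) → 13 < s →
    ((G : Graph) → AlmostIntersecting s G → ¬ IsStar G → size G ≤ 2 * s + 3)
    × ((G : Graph) →
        (AlmostIntersecting s G × ¬ IsStar G × size G ≡ 2 * s + 3) ⇔ IsK2PlusE s G)
theorem4p2 s 13<s = bound , characterisation
  where
  8≤s : 8 ≤ s
  8≤s = ≤-trans (m≤m+n 8 6) 13<s

  bound : ∀ G → AlmostIntersecting s G → ¬ IsStar G → size G ≤ 2 * s + 3
  bound G ai ¬star with size G ≤? 2 * s + 3
  ... | yes small = small
  ... | no ¬small = contradiction (≤-reflexive (proj₂ (proj₂ (K2+E⇒properties G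
          (large-nonStar⇒K2+E G 8≤s ai ¬star (<⇒≤ (≰⇒> ¬small))))))) ¬small

  characterisation : ∀ G → (AlmostIntersecting s G × ¬ IsStar G × size G ≡ 2 * s + 3) ⇔ IsK2PlusE s G
  characterisation G = mk⇔
    (λ (ai , ¬star , size≡) → large-nonStar⇒K2+E G 8≤s ai ¬star (≤-reflexive (sym size≡)))
    (K2+E⇒properties G)
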